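{- Let $n\geq 9$ and let $A\subseteq\{0,1\}^n$ with $|A|=\lceil 2^{n/4}\rceil$ and $\mathbf{0}\in A$. Then the interaction graph $G(f^A)$ has at least $n^2/9$ arcs.
   Context: $\mathbf{0}$ is the all-zero configuration in $\{0,1\}^n$. For $A\subseteq\{0,1\}^n$ with $\mathbf{0}\in A$, $f^A:\{0,1\}^n\to\{0,1\}^n$ is the map with $f^A(a)=\mathbf{0}$ for all $a\in A$ and $f^A(b)=b$ for all $b\notin A$. For $i\in[n]$, $e_i$ is the configuration with a $1$ exactly in component $i$, and $x+y$ is componentwise addition modulo 2. For a map $f=(f_1,\dots,f_n):\{0,1\}^n\to\{0,1\}^n$, the interaction graph $G(f)$ has vertex set $[n]$ and an arc from $j$ to $i$ (loops allowed) iff there is $x$ with $f_i(x)\neq f_i(x+e_j)$. -}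

module Defs where

open import Data.Bool using (Bool; true; false; _xor_)
open import Data.Bool.Properties using () renaming (_≟_ to _≟B_)
open import Data.Fin using (Fin; _≟_)
open import Data.Nat using (ℕ; _^_; _∸_; _<_; _≤_)
open import Data.Vec using (Vec; replicate; lookup; zipWith; tabulate)
open import Data.Vec.Properties using (≡-dec)
open import Data.List using (List)
open import Data.List.Relation.Unary.Any using (any?)
open import Data.Product using (∃; _×_)
open import Relation.Nullary using (does; ¬_)
open import Relation.Binary.PropositionalEquality using (_≡_)

-- Configurations in {0,1}^n, with 1 = true
Config : ℕ → Set
Config n = Vec Bool n

𝟎 : ∀ {n} → Config n
𝟎 = replicate _ false

e : ∀ {n} → Fin n → Config n
e i = tabulate λ k → does (k ≟ i)

_⊕_ : ∀ {n} → Config n → Config n → Config n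
_⊕_ = zipWith _xor_

fA : ∀ {n} → List (Config n) → Config n → Config n
fA A x with any? (≡-dec _≟B_ x) A
... | Relation.Nullary.yes _ = 𝟎
... | Relation.Nullary.no _ = x

-- arc from j to i in the interaction graph G(f)
Arc : ∀ {n} → (Config n → Config n) → Fin n → Fin n → Set
Arc f j i = ∃ λ x → ¬ (lookup (f x) i ≡ lookup (f (x ⊕ e j)) i)

-- m = ⌈ 2^(n/4) ⌉  ⇔  2^n ≤ m^4  and  (m-1)^4 < 2^n
IsCeil2^n/4 : ℕ → ℕ → Set
IsCeil2^n/4 n m = (2 ^ n ≤ m ^ 4) × ((m ∸ 1) ^ 4 < 2 ^ n)

{-# OPTIONS --safe #-}
module Submission where

-- Let S be the set of coordinates on which some point of A is 1. A lies in the subcube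
-- spanned by S, so 2^n ≤ |A|^4 ≤ 2^(4|S|) and |S| ≥ n/4. Fix i ∈ S and say that j ≠ i
-- escapes at i if flipping j takes some x ∈ A with xᵢ = 1 out of A; then
-- f^A(x)ᵢ = 0 ≠ 1 = f^A(x + eⱼ)ᵢ, so j → i is an arc. The c coordinates j ≠ i that do not
-- escape keep {x ∈ A | xᵢ = 1} closed under flipping, so this set, which misses 𝟎,
-- contains a c-dimensional subcube: 2^c + 1 ≤ |A|, whence 4c < n. Hence at least
-- (3/4)(n - 1) coordinates escape at each of the ≥ n/4 coordinates i ∈ S, and
-- (3/16) n (n - 1) ≥ n²/9 once n ≥ 3.

open import Defs
open import Data.Nat using (ℕ; suc; _+_; _*_; _^_; _∸_; _≤_; _<_; z≤n; s≤s)
open import Data.Nat.Properties hiding (_≟_)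
open import Data.Nat.Tactic.RingSolver using (solve-∀)
open import Data.Fin using (Fin; _≟_)
open import Data.Fin.Properties using (pigeonhole)
open import Data.Bool using (true; false; _xor_; not)
open import Data.Bool.Properties using (¬-not; not-¬; xor-identityʳ; xor-comm; true-xor) renaming (_≟_ to _≟B_)
open import Data.Vec using (lookup)
open import Data.Vec.Properties using (≡-dec; lookup-zipWith; lookup-replicate; lookup∘tabulate; tabulate∘lookup; tabulate-cong)
open import Data.Product using (_×_; _,_; ∃; proj₁; proj₂)
open import Data.Sum using (inj₁; inj₂)
open import Data.List as List using (List; []; _∷_; _++_; [_]; length; filter; allFin; map; concat)
open import Data.List.Properties using (length-++; length-map; length-tabulate)
open import Data.List.Relation.Unary.Any as Any using (here; there; any?)
open import Data.List.Relation.Unary.All as All using (All; []; _∷_)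
open import Data.List.Relation.Unary.All.Properties using (all-filter; ++⁺; concat⁺) renaming (map⁺ to All-map⁺)
open import Data.List.Relation.Unary.AllPairs as AllPairs using ([]; _∷_)
import Data.List.Relation.Unary.AllPairs.Properties as AllPairs
open import Data.List.Relation.Unary.Unique.Propositional using (Unique)
open import Data.List.Relation.Unary.Unique.Propositional.Properties as Unique using (filter⁺; allFin⁺; Unique[x∷xs]⇒x∉xs)
open import Data.List.Relation.Binary.Disjoint.Propositional using (Disjoint)
open import Data.List.Relation.Binary.Subset.Propositional using (_⊆_)
open import Data.List.Membership.Propositional using (_∈_; _∉_; find; lose)
open import Data.List.Membership.Propositional.Properties using (∈-lookup; ∈-filter⁺; ∈-filter⁻; ∈-allFin; ∈-++⁻; ∈-++⁺ˡ; ∈-++⁺ʳ; ∈-map⁻)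
open import Data.List.Membership.Setoid.Properties using (index-injective)
open import Relation.Nullary using (yes; no; does; ¬?; contradiction)
open import Relation.Nullary.Decidable using (_×-dec_)
open import Relation.Unary using (Pred; Decidable)
open import Relation.Unary.Properties using (∁?)
open import Relation.Binary.PropositionalEquality hiding ([_])
open import Function using (_∘_)

module _ {a} {X : Set a} where

  Unique⇒lookup-distinct : ∀ {xs : List X} → Unique xs →
                           ∀ {i j} → i Data.Fin.< j → List.lookup xs i ≢ List.lookup xs j
  Unique⇒lookup-distinct (x∉xs ∷ _)  {Fin.zero} {Fin.suc j} _         = All.lookup x∉xs (∈-lookup j)
  Unique⇒lookup-distinct (_ ∷ uxs) {Fin.suc i} {Fin.suc j} (s≤s i<j) = Unique⇒lookup-distinct uxs i<j

  Unique-⊆⇒length≤ : ∀ {xs ys : List X} → Unique xs → xs ⊆ ys → length xs ≤ length ys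
  Unique-⊆⇒length≤ {xs} {ys} uxs xs⊆ys = ≮⇒≥ λ ys<xs →
    let (i , j , i<j , same-index) = pigeonhole ys<xs position
    in Unique⇒lookup-distinct uxs i<j
         (index-injective (setoid X) (xs⊆ys (∈-lookup i)) (xs⊆ys (∈-lookup j)) same-index)
    where
      position : Fin (length xs) → Fin (length ys)
      position k = Any.index (xs⊆ys (∈-lookup k))

  length-filter-∁ : ∀ {p} {P : Pred X p} (P? : Decidable P) xs →
                    length (filter P? xs) + length (filter (∁? P?) xs) ≡ length xs
  length-filter-∁ P? [] = refl
  length-filter-∁ P? (x ∷ xs) with P? x
  ... | yes _ = cong suc (length-filter-∁ P? xs)
  ... | no  _ = trans (+-suc _ _) (cong suc (length-filter-∁ P? xs))

  length-concat-≥ : ∀ {m d} {xss : List (List X)} → All (λ xs → m ≤ d * length xs) xss →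
                    length xss * m ≤ d * length (concat xss)
  length-concat-≥ {m} {d} {[]} [] = ≤-reflexive (sym (*-zeroʳ d))
  length-concat-≥ {m} {d} {xs ∷ xss} (m≤ ∷ ms≤) = begin
    m + length xss * m                       ≤⟨ +-mono-≤ m≤ (length-concat-≥ {d = d} ms≤) ⟩
    d * length xs + d * length (concat xss)  ≡⟨ *-distribˡ-+ d (length xs) _ ⟨
    d * (length xs + length (concat xss))    ≡⟨ cong (d *_) (length-++ xs) ⟨
    d * length (xs ++ concat xss)            ∎
    where open ≤-Reasoning

^-cancelʳ-≤ : ∀ {m n} → 2 ^ m ≤ 2 ^ n → m ≤ n
^-cancelʳ-≤ 2^m≤2^n = ≮⇒≥ λ n<m → <⇒≱ (^-monoʳ-< 2 (s≤s (s≤s z≤n)) n<m) 2^m≤2^n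

^-cancelʳ-< : ∀ {m n} → 2 ^ m < 2 ^ n → m < n
^-cancelʳ-< 2^m<2^n = ≰⇒> λ n≤m → <⇒≱ 2^m<2^n (^-monoʳ-≤ 2 n≤m)

module _ {n : ℕ} where

  lookup-⊕ : ∀ (x y : Config n) k → lookup (x ⊕ y) k ≡ lookup x k xor lookup y k
  lookup-⊕ x y k = lookup-zipWith _xor_ k x y

  lookup-e : ∀ j k → lookup (e {n} j) k ≡ does (k ≟ j)
  lookup-e j k = lookup∘tabulate _ k

  lookup-⊕-e-≢ : ∀ (x : Config n) {j k} → k ≢ j → lookup (x ⊕ e j) k ≡ lookup x k
  lookup-⊕-e-≢ x {j} {k} k≢j with k ≟ j | lookup-⊕ x (e j) k | lookup-e j k
  ... | yes k≡j | _  | _  = contradiction k≡j k≢j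
  ... | no  _   | eq | ej = trans eq (trans (cong (lookup x k xor_) ej) (xor-identityʳ _))

  lookup-⊕-e-≡ : ∀ (x : Config n) j → lookup (x ⊕ e j) j ≡ not (lookup x j)
  lookup-⊕-e-≡ x j with j ≟ j | lookup-⊕ x (e j) j | lookup-e j j
  ... | no  j≢j | _  | _  = contradiction refl j≢j
  ... | yes _   | eq | ej =
    trans eq (trans (cong (lookup x j xor_) ej) (trans (xor-comm _ true) (true-xor _)))

  lookup-𝟎 : ∀ k → lookup (𝟎 {n}) k ≡ false
  lookup-𝟎 k = lookup-replicate k false

  Config-ext : ∀ {x y : Config n} → (∀ k → lookup x k ≡ lookup y k) → x ≡ y
  Config-ext {x} {y} x≗y = trans (sym (tabulate∘lookup x)) (trans (tabulate-cong x≗y) (tabulate∘lookup y))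

  cube : List (Fin n) → Config n → List (Config n)
  cube []      x = [ x ]
  cube (j ∷ J) x = cube J x ++ cube J (x ⊕ e j)

  length-cube : ∀ J x → length (cube J x) ≡ 2 ^ length J
  length-cube []      x = refl
  length-cube (j ∷ J) x = begin
    length (cube J x ++ cube J (x ⊕ e j))             ≡⟨ length-++ (cube J x) ⟩
    length (cube J x) + length (cube J (x ⊕ e j))     ≡⟨ cong₂ _+_ (length-cube J x) (length-cube J (x ⊕ e j)) ⟩
    2 ^ length J + 2 ^ length J                       ≡⟨ cong (2 ^ length J +_) (+-identityʳ _) ⟨
    2 ^ suc (length J)                                ∎
    where open ≡-Reasoning

  cube-closed : ∀ {p} (P : Pred (Config n) p) J →
                (∀ {y j} → j ∈ J → P y → P (y ⊕ e j)) → ∀ {x} → P x → All P (cube J x)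
  cube-closed P []      closed px = px ∷ []
  cube-closed P (j ∷ J) closed px =
    ++⁺ (cube-closed P J (closed ∘ there) px) (cube-closed P J (closed ∘ there) (closed (here refl) px))

  cube-fixes : ∀ J {x y} → y ∈ cube J x → ∀ k → k ∉ J → lookup y k ≡ lookup x k
  cube-fixes []      (here refl) k _ = refl
  cube-fixes (j ∷ J) {x} y∈ k k∉ with ∈-++⁻ (cube J x) y∈
  ... | inj₁ y∈₁ = cube-fixes J y∈₁ k (k∉ ∘ there)
  ... | inj₂ y∈₂ = trans (cube-fixes J y∈₂ k (k∉ ∘ there)) (lookup-⊕-e-≢ x (k∉ ∘ here))

  cube-unique : ∀ J {x} → Unique J → Unique (cube J x)
  cube-unique []      _ = [] ∷ []
  cube-unique (j ∷ J) {x} uJ@(_ ∷ uJ′) = Unique.++⁺ (cube-unique J uJ′) (cube-unique J uJ′) halves-disjoint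
    where
      j∉J = Unique[x∷xs]⇒x∉xs uJ
      halves-disjoint : Disjoint (cube J x) (cube J (x ⊕ e j))
      halves-disjoint (y∈₁ , y∈₂) =
        not-¬ (cube-fixes J y∈₁ j j∉J) (trans (cube-fixes J y∈₂ j j∉J) (lookup-⊕-e-≡ x j))

  ∈-cube : ∀ J {x y} → (∀ k → k ∉ J → lookup y k ≡ lookup x k) → y ∈ cube J x
  ∈-cube []      agree = here (Config-ext λ k → agree k λ ())
  ∈-cube (j ∷ J) {x} {y} agree with lookup y j ≟B lookup x j
  ... | yes yⱼ≡xⱼ = ∈-++⁺ˡ (∈-cube J agree′)
    where
      agree′ : ∀ k → k ∉ J → lookup y k ≡ lookup x k
      agree′ k k∉ with k ≟ j
      ... | yes refl = yⱼ≡xⱼ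
      ... | no  k≢j  = agree k λ { (here k≡j) → k≢j k≡j ; (there k∈) → k∉ k∈ }
  ... | no  yⱼ≢xⱼ = ∈-++⁺ʳ (cube J x) (∈-cube J agree′)
    where
      agree′ : ∀ k → k ∉ J → lookup y k ≡ lookup (x ⊕ e j) k
      agree′ k k∉ with k ≟ j
      ... | yes refl = trans (¬-not yⱼ≢xⱼ) (sym (lookup-⊕-e-≡ x j))
      ... | no  k≢j  = trans (agree k λ { (here k≡j) → k≢j k≡j ; (there k∈) → k∉ k∈ }) (sym (lookup-⊕-e-≢ x k≢j))

k≤l+c∧4c≤k⇒3k≤4l : ∀ {k l c} → k ≤ l + c → 4 * c ≤ k → 3 * k ≤ 4 * l
k≤l+c∧4c≤k⇒3k≤4l {k} {l} {c} k≤l+c 4c≤k = +-cancelˡ-≤ k (3 * k) (4 * l) (begin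
  4 * k          ≤⟨ *-monoʳ-≤ 4 k≤l+c ⟩
  4 * (l + c)    ≡⟨ *-distribˡ-+ 4 l c ⟩
  4 * l + 4 * c  ≤⟨ +-monoʳ-≤ (4 * l) 4c≤k ⟩
  4 * l + k      ≡⟨ +-comm (4 * l) k ⟩
  k + 4 * l      ∎)
  where open ≤-Reasoning

-- Here n = k + 1; only n ≥ 3 is needed.
[1+k]²≤9b : ∀ {k s b} → 2 ≤ k → suc k ≤ 4 * s → s * (3 * k) ≤ 4 * b → suc k * suc k ≤ 9 * b
[1+k]²≤9b {k} {s} {b} 2≤k 1+k≤4s 3ks≤4b = *-cancelˡ-≤ 16 (begin
  16 * (suc k * suc k)   ≡⟨ *-assoc 16 (suc k) (suc k) ⟨
  16 * suc k * suc k     ≤⟨ *-monoˡ-≤ (suc k) 16[1+k]≤27k ⟩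
  27 * k * suc k         ≤⟨ *-monoʳ-≤ (27 * k) 1+k≤4s ⟩
  27 * k * (4 * s)       ≡⟨ regroup k s ⟩
  36 * (s * (3 * k))     ≤⟨ *-monoʳ-≤ 36 3ks≤4b ⟩
  36 * (4 * b)           ≡⟨ *-assoc 36 4 b ⟨
  144 * b                ≡⟨ *-assoc 16 9 b ⟩
  16 * (9 * b)           ∎)
  where
    open ≤-Reasoning
    regroup : ∀ k s → 27 * k * (4 * s) ≡ 36 * (s * (3 * k))
    regroup = solve-∀
    16[1+k]≤27k : 16 * suc k ≤ 27 * k
    16[1+k]≤27k = begin
      16 * suc k      ≡⟨ *-suc 16 k ⟩
      16 + 16 * k     ≤⟨ +-monoˡ-≤ (16 * k) (≤-trans (m≤m+n 16 6) (*-monoʳ-≤ 11 2≤k)) ⟩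
      11 * k + 16 * k ≡⟨ *-distribʳ-+ k 11 16 ⟨
      27 * k          ∎

module _ {k : ℕ} (A : List (Config (suc k))) where

  open import Data.List.Membership.DecPropositional {A = Config (suc k)} (≡-dec _≟B_) using (_∈?_)

  fA-∈ : ∀ {x} → x ∈ A → fA A x ≡ 𝟎
  fA-∈ {x} x∈A with any? (≡-dec _≟B_ x) A
  ... | yes _   = refl
  ... | no  x∉A = contradiction x∈A x∉A

  fA-∉ : ∀ {x} → x ∉ A → fA A x ≡ x
  fA-∉ {x} x∉A with any? (≡-dec _≟B_ x) A
  ... | yes x∈A = contradiction x∈A x∉A
  ... | no  _   = refl

  one-somewhere? : Decidable (λ i → Any.Any (λ a → lookup a i ≡ true) A)
  one-somewhere? i = any? (λ a → lookup a i ≟B true) A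

  support : List (Fin (suc k))
  support = filter one-somewhere? (allFin _)

  A⊆cube-support : A ⊆ cube support 𝟎
  A⊆cube-support {a} a∈A = ∈-cube support outside-support
    where
      outside-support : ∀ i → i ∉ support → lookup a i ≡ lookup 𝟎 i
      outside-support i i∉ with lookup a i ≟B true
      ... | yes aᵢ≡1 = contradiction (∈-filter⁺ one-somewhere? (∈-allFin i) (lose a∈A aᵢ≡1)) i∉
      ... | no  aᵢ≢1 = trans (¬-not aᵢ≢1) (sym (lookup-𝟎 i))

  1+k≤4*|support| : Unique A → 2 ^ suc k ≤ length A ^ 4 → suc k ≤ 4 * length support
  1+k≤4*|support| uA 2^n≤m⁴ = ^-cancelʳ-≤ (begin
    2 ^ suc k                    ≤⟨ 2^n≤m⁴ ⟩
    length A ^ 4                 ≤⟨ ^-monoˡ-≤ 4 m≤2^s ⟩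
    (2 ^ length support) ^ 4     ≡⟨ ^-*-assoc 2 (length support) 4 ⟩
    2 ^ (length support * 4)     ≡⟨ cong (2 ^_) (*-comm (length support) 4) ⟩
    2 ^ (4 * length support)     ∎)
    where
      open ≤-Reasoning
      m≤2^s : length A ≤ 2 ^ length support
      m≤2^s = ≤-trans (Unique-⊆⇒length≤ uA A⊆cube-support) (≤-reflexive (length-cube support 𝟎))

  Escape : Fin (suc k) → Fin (suc k) → Set
  Escape i j = j ≢ i × Any.Any (λ x → lookup x i ≡ true × x ⊕ e j ∉ A) A

  escape? : ∀ i → Decidable (Escape i)
  escape? i j = ¬? (j ≟ i) ×-dec any? (λ x → (lookup x i ≟B true) ×-dec ¬? (x ⊕ e j ∈? A)) A

  Escape⇒Arc : ∀ {i j} → Escape i j → Arc (fA A) j i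
  Escape⇒Arc {i} {j} (j≢i , witness) with find witness
  ... | x , x∈A , xᵢ≡1 , x⊕eⱼ∉A = x , λ same → not-¬ refl (begin
    false                                ≡⟨ lookup-𝟎 i ⟨
    lookup 𝟎 i                           ≡⟨ cong (λ z → lookup z i) (fA-∈ x∈A) ⟨
    lookup (fA A x) i                    ≡⟨ same ⟩
    lookup (fA A (x ⊕ e j)) i            ≡⟨ cong (λ z → lookup z i) (fA-∉ x⊕eⱼ∉A) ⟩
    lookup (x ⊕ e j) i                   ≡⟨ lookup-⊕-e-≢ x (j≢i ∘ sym) ⟩
    lookup x i                           ≡⟨ xᵢ≡1 ⟩
    true                                 ∎)
    where open ≡-Reasoning

  escapers : Fin (suc k) → List (Fin (suc k))
  escapers i = filter (escape? i) (allFin _)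

  stayers : Fin (suc k) → List (Fin (suc k))
  stayers i = filter (∁? (_≟ i)) (filter (∁? (escape? i)) (allFin _))

  OneAt : Fin (suc k) → Config (suc k) → Set
  OneAt i y = y ∈ A × lookup y i ≡ true

  stayers-closed : ∀ i {y j} → j ∈ stayers i → OneAt i y → OneAt i (y ⊕ e j)
  stayers-closed i {y} {j} j∈ (y∈A , yᵢ≡1)
    with j∈′ , j≢i ← ∈-filter⁻ (∁? (_≟ i)) j∈
    with _ , ¬escape ← ∈-filter⁻ (∁? (escape? i)) {xs = allFin _} j∈′
    with y ⊕ e j ∈? A
  ... | yes y⊕eⱼ∈A = y⊕eⱼ∈A , trans (lookup-⊕-e-≢ y (j≢i ∘ sym)) yᵢ≡1
  ... | no  y⊕eⱼ∉A = contradiction (j≢i , lose y∈A (yᵢ≡1 , y⊕eⱼ∉A)) ¬escape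

  -- The subcube through a witness a of i ∈ support, spanned by stayers i, lies in A and avoids 𝟎.
  1+2^stayers≤|A| : Unique A → 𝟎 ∈ A → ∀ {i} → i ∈ support → suc (2 ^ length (stayers i)) ≤ length A
  1+2^stayers≤|A| uA 𝟎∈A {i} i∈support
    with a , a∈A , aᵢ≡1 ← find (proj₂ (∈-filter⁻ one-somewhere? {xs = allFin _} i∈support)) = begin
      suc (2 ^ length (stayers i))       ≡⟨ cong suc (length-cube (stayers i) a) ⟨
      length (𝟎 ∷ cube (stayers i) a)    ≤⟨ Unique-⊆⇒length≤ (𝟎∉cube ∷ cube-unique (stayers i) stayers-unique) 𝟎∷cube⊆A ⟩
      length A                           ∎
    where
      open ≤-Reasoning
      stayers-unique : Unique (stayers i)
      stayers-unique = filter⁺ (∁? (_≟ i)) (filter⁺ (∁? (escape? i)) (allFin⁺ _))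
      cube⊆OneAt : All (OneAt i) (cube (stayers i) a)
      cube⊆OneAt = cube-closed (OneAt i) (stayers i) (stayers-closed i) (a∈A , aᵢ≡1)
      𝟎∉cube : All (𝟎 ≢_) (cube (stayers i) a)
      𝟎∉cube = All.map (λ { (_ , 1≡yᵢ) refl → not-¬ (lookup-𝟎 i) 1≡yᵢ }) cube⊆OneAt
      𝟎∷cube⊆A : 𝟎 ∷ cube (stayers i) a ⊆ A
      𝟎∷cube⊆A (here refl) = 𝟎∈A
      𝟎∷cube⊆A (there y∈) = proj₁ (All.lookup cube⊆OneAt y∈)

  k≤escapers+stayers : ∀ i → k ≤ length (escapers i) + length (stayers i)
  k≤escapers+stayers i = ≤-pred (begin
    suc k                                          ≡⟨ length-tabulate {n = suc k} (λ j → j) ⟨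
    length (allFin (suc k))                        ≡⟨ length-filter-∁ (escape? i) (allFin (suc k)) ⟨
    length (escapers i) + length stuck             ≡⟨ cong (length (escapers i) +_) (length-filter-∁ (_≟ i) stuck) ⟨
    length (escapers i) + (length (filter (_≟ i) stuck) + length (stayers i))
                                                   ≤⟨ +-monoʳ-≤ (length (escapers i)) (+-monoˡ-≤ (length (stayers i)) at-most-i) ⟩
    length (escapers i) + suc (length (stayers i)) ≡⟨ +-suc _ _ ⟩
    suc (length (escapers i) + length (stayers i)) ∎)
    where
      open ≤-Reasoning
      stuck : List (Fin (suc k))
      stuck = filter (∁? (escape? i)) (allFin (suc k))
      at-most-i : length (filter (_≟ i) stuck) ≤ length [ i ]
      at-most-i = Unique-⊆⇒length≤ {ys = [ i ]} (filter⁺ (_≟ i) (filter⁺ (∁? (escape? i)) (allFin⁺ (suc k))))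
                    λ j∈ → here (proj₂ (∈-filter⁻ (_≟ i) {xs = stuck} j∈))

  3k≤4*|escapers| : Unique A → 𝟎 ∈ A → (length A ∸ 1) ^ 4 < 2 ^ suc k →
                  ∀ {i} → i ∈ support → 3 * k ≤ 4 * length (escapers i)
  3k≤4*|escapers| uA 𝟎∈A [m-1]⁴<2^n {i} i∈support =
    k≤l+c∧4c≤k⇒3k≤4l {c = length (stayers i)} (k≤escapers+stayers i) (≤-pred (^-cancelʳ-< (begin-strict
      2 ^ (4 * c)              ≡⟨ cong (2 ^_) (*-comm 4 c) ⟩
      2 ^ (c * 4)              ≡⟨ ^-*-assoc 2 c 4 ⟨
      (2 ^ c) ^ 4              ≤⟨ ^-monoˡ-≤ 4 (∸-monoˡ-≤ 1 (1+2^stayers≤|A| uA 𝟎∈A i∈support)) ⟩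
      (length A ∸ 1) ^ 4       <⟨ [m-1]⁴<2^n ⟩
      2 ^ suc k                ∎)))
    where
      open ≤-Reasoning
      c = length (stayers i)

  arcsInto : Fin (suc k) → List (Fin (suc k) × Fin (suc k))
  arcsInto i = map (λ j → j , i) (escapers i)

  arcs : List (Fin (suc k) × Fin (suc k))
  arcs = concat (map arcsInto support)

  arcsInto-disjoint : ∀ {i i′} → i ≢ i′ → Disjoint (arcsInto i) (arcsInto i′)
  arcsInto-disjoint {i} {i′} i≢i′ (v∈ , v∈′) with ∈-map⁻ (λ j → j , i) v∈ | ∈-map⁻ (λ j → j , i′) v∈′
  ... | _ , _ , refl | _ , _ , refl = i≢i′ refl

  arcs-unique : Unique arcs
  arcs-unique = Unique.concat⁺
    (All-map⁺ (All.tabulate λ {i} _ →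
      Unique.map⁺ {f = λ j → j , i} (cong proj₁) (filter⁺ (escape? i) (allFin⁺ _))))
    (AllPairs.map⁺ (AllPairs.map arcsInto-disjoint (filter⁺ one-somewhere? (allFin⁺ _))))

  arcs-are-arcs : All (λ (j , i) → Arc (fA A) j i) arcs
  arcs-are-arcs = concat⁺ (All-map⁺ {f = arcsInto} (All.tabulate {xs = support} λ {i} _ →
    All-map⁺ {f = λ j → j , i} (All.map Escape⇒Arc (all-filter (escape? i) (allFin _)))))

  |support|*3k≤4*|arcs| : Unique A → 𝟎 ∈ A → (length A ∸ 1) ^ 4 < 2 ^ suc k →
                          length support * (3 * k) ≤ 4 * length arcs
  |support|*3k≤4*|arcs| uA 𝟎∈A [m-1]⁴<2^n = begin
    length support * (3 * k)                 ≡⟨ cong (_* (3 * k)) (length-map arcsInto support) ⟨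
    length (map arcsInto support) * (3 * k)  ≤⟨ length-concat-≥ {d = 4} (All-map⁺ (All.tabulate 3k≤4*|arcsInto|)) ⟩
    4 * length arcs                          ∎
    where
      open ≤-Reasoning
      3k≤4*|arcsInto| : ∀ {i} → i ∈ support → 3 * k ≤ 4 * length (arcsInto i)
      3k≤4*|arcsInto| {i} i∈support = ≤-trans (3k≤4*|escapers| uA 𝟎∈A [m-1]⁴<2^n i∈support)
        (≤-reflexive (cong (4 *_) (sym (length-map (λ j → j , i) (escapers i)))))

lemma6 : (n : ℕ) → 9 ≤ n → (A : List (Config n)) → Unique A →
           IsCeil2^n/4 n (length A) → 𝟎 ∈ A →
           ∃ λ (arcs : List (Fin n × Fin n)) → Unique arcs ×
             All (λ { (j , i) → Arc (fA A) j i }) arcs ×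
             n * n ≤ 9 * length arcs
lemma6 (suc k) (s≤s 8≤k) A uA (2^n≤m⁴ , [m-1]⁴<2^n) 𝟎∈A =
  arcs A , arcs-unique A , All.map (λ { {j , i} arc → arc }) (arcs-are-arcs A) ,
  [1+k]²≤9b {s = length (support A)} {b = length (arcs A)}
    (≤-trans (s≤s (s≤s z≤n)) 8≤k)
    (1+k≤4*|support| A uA 2^n≤m⁴)
    (|support|*3k≤4*|arcs| A uA 𝟎∈A [m-1]⁴<2^n)
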